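{- For every even integer $d\ge 2$ and every odd integer $t\ge 3$, there exists a graph with treewidth at most $t$ that contains a distance-$d$ half graph of order $$ 2^{\binom{\frac12(d+t-5)}{\frac12(t-3)}}. $$
   Context: All graphs are finite, undirected and simple; $\mathrm{dist}$ is the shortest-path distance. For integers $d,\ell\ge1$, $2\ell$ pairwise distinct vertices $a_1,\dots,a_\ell,b_1,\dots,b_\ell$ of a graph form a distance-$d$ half graph of order $\ell$ if for all $i,j\in[1,\ell]$ we have $\mathrm{dist}(b_i,a_j)\le d$ if and only if $i<j$. Treewidth is the standard graph parameter (minimum over tree decompositions of the maximum bag size minus one). -}

module Defs where

open import Data.Nat using (ℕ; zero; suc; _≤_; _+_)
open import Data.Fin using (Fin; zero; suc; inject₁; fromℕ; toℕ) renaming (_<_ to _<ᶠ_)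
open import Data.Fin.Subset using (Subset; _∈_; ∣_∣)
open import Data.Product using (Σ; _×_; ∃)
open import Data.Sum using (_⊎_)
open import Function.Definitions using (Injective)
open import Relation.Binary.PropositionalEquality using (_≡_; _≢_)
open import Relation.Nullary using (¬_)
open import Level using (0ℓ)

record Graph (n : ℕ) : Set₁ where
  field
    Adj    : Fin n → Fin n → Set
    sym    : ∀ {u v} → Adj u v → Adj v u
    irrefl : ∀ {u} → ¬ Adj u u
open Graph public

data Walk {n : ℕ} (G : Graph n) : Fin n → Fin n → ℕ → Set where
  nil  : ∀ {u} → Walk G u u 0
  cons : ∀ {u v w k} → Adj G u v → Walk G v w k → Walk G u w (suc k)

-- dist(u,v) ≤ d  (shortest-path distance; unreachable pairs have infinite distance)
DistLE : {n : ℕ} → Graph n → ℕ → Fin n → Fin n → Set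
DistLE G d u v = Σ ℕ λ k → k ≤ d × Walk G u v k

data WalkIn {n : ℕ} (G : Graph n) (P : Fin n → Set) : Fin n → Fin n → Set where
  nil  : ∀ {u} → P u → WalkIn G P u u
  cons : ∀ {u v w} → P u → Adj G u v → WalkIn G P v w → WalkIn G P u w

ConnectedOn : {n : ℕ} → Graph n → (Fin n → Set) → Set
ConnectedOn G P = ∀ u v → P u → P v → WalkIn G P u v

Connected : {n : ℕ} → Graph n → Set
Connected G = ∀ u v → Σ ℕ λ k → Walk G u v k

-- A cycle of length k+1 ≥ 3: distinct vertices c 0, …, c k, consecutive ones adjacent, c k adjacent to c 0.
HasCycle : {n : ℕ} → Graph n → Set
HasCycle {n} G = Σ ℕ λ k → 2 ≤ k × Σ (Fin (suc k) → Fin n) λ c →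
  Injective _≡_ _≡_ c × (∀ (i : Fin k) → Adj G (c (inject₁ i)) (c (suc i))) × Adj G (c (fromℕ k)) (c zero)

IsTree : {m : ℕ} → Graph m → Set
IsTree {m} T = 1 ≤ m × Connected T × ¬ HasCycle T

record TreeDecomposition {n : ℕ} (G : Graph n) (t : ℕ) : Set₁ where
  field
    m          : ℕ
    T          : Graph m
    tree       : IsTree T
    bag        : Fin m → Subset n
    covVertex  : ∀ v → Σ (Fin m) λ x → v ∈ bag x
    covEdge    : ∀ u v → Adj G u v → Σ (Fin m) λ x → (u ∈ bag x × v ∈ bag x)
    connected  : ∀ v → ConnectedOn T (λ x → v ∈ bag x)
    width      : ∀ x → ∣ bag x ∣ ≤ suc t

TreewidthAtMost : {n : ℕ} → Graph n → ℕ → Set₁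
TreewidthAtMost G t = TreeDecomposition G t

record HalfGraph {n : ℕ} (G : Graph n) (d ℓ : ℕ) : Set where
  field
    a      : Fin ℓ → Fin n
    b      : Fin ℓ → Fin n
    a-inj  : Injective _≡_ _≡_ a
    b-inj  : Injective _≡_ _≡_ b
    a≢b    : ∀ i j → a i ≢ b j
    half⇒  : ∀ i j → DistLE G d (b i) (a j) → i <ᶠ j
    half⇐  : ∀ i j → i <ᶠ j → DistLE G d (b i) (a j)

module Submission where

-- The graphs are built by induction, carrying more than the theorem asks for: every walk from
-- some b_i to some a_j has length at least d, and there is a rooted tree decomposition of width t
-- with a bag containing both a_i and b_i, for each i. From such a gadget G₁ for (d, t) of order p
-- and a gadget G₂ for (d + 2, t − 2) of order q we get one for (d + 2, t) of order pq: take G₁ and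
-- p disjoint copies of G₂, and join b_i to every b-vertex and a_i to every a-vertex of the i-th
-- copy. The new pairs are those of the copies, ordered lexicographically. A b–a walk of length at
-- most d + 2 either stays inside one copy, or crosses through G₁ from some b_i to some a_j in at
-- most d steps, which forces i < j. Adding a_i and b_i to every bag of the i-th copy's
-- decomposition and hanging it below the bag of the pair (a_i, b_i) costs two in width. With
-- d = 2D + 2 and t = 2K + 3 the orders obey Pascal's rule in (D, K), whence 2^C(D+K, K).

open import Data.Bool using (Bool; true; false)
open import Data.Empty using (⊥; ⊥-elim)
open import Data.Fin using (Fin; zero; suc; inject₁; fromℕ; toℕ; combine; remQuot) renaming (_<_ to _<ᶠ_)
open import Data.Fin.Properties
  using (toℕ<n; toℕ-inject₁; +↔⊎; *↔×; 2↔Bool; 1↔⊤; combine-monoˡ-<; toℕ-combine; combine-remQuot)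
  renaming (<-cmp to <ᶠ-cmp)
open import Data.Fin.Subset using (Subset; ∣_∣; ⁅_⁆; _∪_) renaming (_∈_ to _∈ₛ_; ⊥ to ∅)
open import Data.Fin.Subset.Properties
  using (x∈⁅x⁆; x∈⁅y⁆⇒x≡y; x∈p∪q⁻; x∈p∪q⁺; ∉⊥; ∣⊥∣≡0; ∪-identityˡ)
open import Data.List using (List; []; _∷_; length; map; allFin)
open import Data.List.Extrema.Nat using (argmax; f[xs]≤f[argmax])
open import Data.List.Membership.Propositional using (_∈_)
open import Data.List.Membership.Propositional.Properties using (∈-allFin; ∈-map⁺; ∈-map⁻)
open import Data.List.Properties using (length-map)
open import Data.List.Relation.Unary.All as All using ()
open import Data.List.Relation.Unary.Any using (here; there)
open import Data.Nat using (ℕ; zero; suc; _≤_; _<_; _+_; _*_; _∸_; _^_; ⌊_/2⌋; z≤n; s≤s)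
open import Data.Nat.Combinatorics using (_C_; nCn≡1; nCk+nC[k+1]≡[n+1]C[k+1])
open import Data.Nat.Divisibility using (_∣_; divides; ∣-refl; ∣m∣n⇒∣m+n)
open import Data.Nat.Properties
open import Data.Product using (Σ; ∃; ∃₂; _×_; _,_; proj₁; proj₂; uncurry)
import Data.Product as Prod
open import Data.Product.Function.NonDependent.Propositional using (_×-↔_)
open import Data.Product.Properties using (,-injective)
open import Data.Product.Relation.Binary.Lex.Strict using (×-Lex)
open import Data.Sum using (_⊎_; inj₁; inj₂)
import Data.Sum as Sum
open import Data.Sum.Function.Propositional using (_⊎-↔_)
open import Data.Sum.Properties using (inj₁-injective; inj₂-injective)
open import Data.Unit using (⊤; tt)
open import Data.Vec using (_∷_)
open import Function using (_∘_; _∘′_)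
open import Function.Bundles using (_↔_; Inverse; mk↔ₛ′)
open import Function.Definitions using (Injective)
open import Function.Properties.Inverse using (↔-refl; ↔-sym; ↔-trans)
open import Relation.Binary.Definitions using (Symmetric; tri<; tri≈; tri>)
open import Relation.Binary.PropositionalEquality
open import Relation.Nullary using (¬_)
open import Defs hiding (sym; irrefl)

data RWalk {V : Set} (E : V → V → Set) : V → V → ℕ → Set where
  nil  : ∀ {u} → RWalk E u u 0
  cons : ∀ {u v w k} → E u v → RWalk E v w k → RWalk E u w (suc k)

module _ {V : Set} {E : V → V → Set} where

  walk-++ : ∀ {u v w k l} → RWalk E u v k → RWalk E v w l → RWalk E u w (k + l)
  walk-++ nil q = q
  walk-++ (cons e p) q = cons e (walk-++ p q)

  walk-snoc : ∀ {u v w k} → RWalk E u v k → E v w → RWalk E u w (suc k)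
  walk-snoc {k = k} p e = subst (RWalk E _ _) (+-comm k 1) (walk-++ p (cons e nil))

  walk-reverse : Symmetric E → ∀ {u v k} → RWalk E u v k → RWalk E v u k
  walk-reverse E-sym nil = nil
  walk-reverse E-sym (cons e p) = walk-snoc (walk-reverse E-sym p) (E-sym e)

walk-map : ∀ {V W : Set} {E : V → V → Set} {F : W → W → Set} (f : V → W) →
           (∀ {u v} → E u v → F (f u) (f v)) → ∀ {u v k} → RWalk E u v k → RWalk F (f u) (f v) k
walk-map f f-edge nil = nil
walk-map f f-edge (cons e p) = cons (f-edge e) (walk-map f f-edge p)

StepsTowards : ∀ {n} (G : Graph n) (P : Fin n → Set) (depth : Fin n → ℕ) (target : Fin n) → Set
StepsTowards {n} G P depth target =
  ∀ {u} → P u → u ≡ target ⊎ Σ (Fin n) λ v → Adj G u v × P v × depth v < depth u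

module _ {n : ℕ} {G : Graph n} {P : Fin n → Set} where

  walkIn-++ : ∀ {u v w} → WalkIn G P u v → WalkIn G P v w → WalkIn G P u w
  walkIn-++ (nil _) q = q
  walkIn-++ (cons pu e p) q = cons pu e (walkIn-++ p q)

  walkIn-head : ∀ {u v} → WalkIn G P u v → P u
  walkIn-head (nil pu) = pu
  walkIn-head (cons pu _ _) = pu

  walkIn-reverse : ∀ {u v} → WalkIn G P u v → WalkIn G P v u
  walkIn-reverse (nil pu) = nil pu
  walkIn-reverse (cons pu e p) = walkIn-++ (walkIn-reverse p) (cons (walkIn-head p) (Graph.sym G e) (nil pu))

  walkIn⇒walk : ∀ {u v} → WalkIn G P u v → ∃ (Walk G u v)
  walkIn⇒walk (nil _) = 0 , nil
  walkIn⇒walk (cons _ e p) with k , q ← walkIn⇒walk p = suc k , cons e q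

  climb : ∀ {depth target} → StepsTowards G P depth target → ∀ {u} → P u → WalkIn G P u target
  climb {depth} {target} step {u} pu = go (suc (depth u)) ≤-refl pu
    where
    go : ∀ r {u} → depth u < r → P u → WalkIn G P u target
    go (suc r) lt pu with step pu
    ... | inj₁ refl = nil pu
    ... | inj₂ (v , e , pv , v<u) = cons pu e (go r (≤-trans v<u (≤-pred lt)) pv)

  connected-towards : ∀ {depth target} → StepsTowards G P depth target → ConnectedOn G P
  connected-towards step u v pu pv = walkIn-++ (climb step pu) (walkIn-reverse (climb step pv))

data LastView : ∀ {k} → Fin (suc k) → Set where
  last  : ∀ {k} → LastView (fromℕ k)
  inner : ∀ {k} (i : Fin k) → LastView (inject₁ i)

lastView : ∀ {k} (i : Fin (suc k)) → LastView i
lastView {zero} zero = last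
lastView {suc k} zero = inner zero
lastView {suc k} (suc i) with lastView i
... | last = last
... | inner j = inner (suc j)

cycle-neighbours : ∀ {k} → 2 ≤ k → (R : Fin (suc k) → Fin (suc k) → Set) → Symmetric R →
  (∀ (i : Fin k) → R (inject₁ i) (suc i)) → R (fromℕ k) zero →
  ∀ i → ∃₂ λ j j' → j ≢ j' × R i j × R i j'
cycle-neighbours (s≤s (s≤s z≤n)) R R-sym step close i with lastView i
... | last = zero , _ , (λ ()) , close , R-sym (step _)
... | inner zero = suc zero , fromℕ _ , (λ ()) , step zero , R-sym close
... | inner (suc j) = suc (suc j) , inject₁ (inject₁ j) , apart , step (suc j) , R-sym (step (inject₁ j))
  where
  apart : suc (suc j) ≢ inject₁ (inject₁ j)
  apart eq = m≢1+n+m (toℕ j) (sym (trans (cong toℕ eq) (trans (toℕ-inject₁ _) (toℕ-inject₁ j))))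

-- At a vertex of maximal depth on a cycle, both cycle neighbours are no deeper, hence equal.
acyclic-by-depth : ∀ {n} (G : Graph n) (depth : Fin n → ℕ) →
  (∀ {x y z} → Adj G x y → Adj G x z → depth y ≤ depth x → depth z ≤ depth x → y ≡ z) →
  ¬ HasCycle G
acyclic-by-depth G depth unique (k , k≥2 , c , c-inj , step , close) =
  collapse (cycle-neighbours k≥2 (λ i j → Adj G (c i) (c j)) (Graph.sym G) step close deepest)
  where
  deepest : Fin (suc k)
  deepest = argmax (depth ∘ c) zero (allFin _)
  below : ∀ j → depth (c j) ≤ depth (c deepest)
  below j = All.lookup (f[xs]≤f[argmax] {f = depth ∘ c} zero (allFin _)) (∈-allFin j)
  collapse : ¬ ∃₂ λ j j' → j ≢ j' × Adj G (c deepest) (c j) × Adj G (c deepest) (c j')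
  collapse (j , j' , j≢j' , e , e') = j≢j' (c-inj (unique e e' (below j) (below j')))

fromList : ∀ {n} → List (Fin n) → Subset n
fromList [] = ∅
fromList (x ∷ xs) = ⁅ x ⁆ ∪ fromList xs

∈-fromList⁺ : ∀ {n} {x : Fin n} {xs} → x ∈ xs → x ∈ₛ fromList xs
∈-fromList⁺ {x = x} (here refl) = x∈p∪q⁺ (inj₁ (x∈⁅x⁆ x))
∈-fromList⁺ (there x∈xs) = x∈p∪q⁺ (inj₂ (∈-fromList⁺ x∈xs))

∈-fromList⁻ : ∀ {n} {x : Fin n} xs → x ∈ₛ fromList xs → x ∈ xs
∈-fromList⁻ [] x∈∅ = ⊥-elim (∉⊥ x∈∅)
∈-fromList⁻ (y ∷ xs) x∈ with x∈p∪q⁻ ⁅ y ⁆ (fromList xs) x∈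
... | inj₁ x∈⁅y⁆ = here (x∈⁅y⁆⇒x≡y y x∈⁅y⁆)
... | inj₂ x∈xs = there (∈-fromList⁻ xs x∈xs)

∣⁅x⁆∪p∣≤1+∣p∣ : ∀ {n} (x : Fin n) (p : Subset n) → ∣ ⁅ x ⁆ ∪ p ∣ ≤ suc ∣ p ∣
∣⁅x⁆∪p∣≤1+∣p∣ zero (true ∷ p) rewrite ∪-identityˡ p = n≤1+n _
∣⁅x⁆∪p∣≤1+∣p∣ zero (false ∷ p) rewrite ∪-identityˡ p = ≤-refl
∣⁅x⁆∪p∣≤1+∣p∣ (suc x) (true ∷ p) = s≤s (∣⁅x⁆∪p∣≤1+∣p∣ x p)
∣⁅x⁆∪p∣≤1+∣p∣ (suc x) (false ∷ p) = ∣⁅x⁆∪p∣≤1+∣p∣ x p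

∣fromList∣≤length : ∀ {n} (xs : List (Fin n)) → ∣ fromList xs ∣ ≤ length xs
∣fromList∣≤length {n} [] = ≤-reflexive (∣⊥∣≡0 n)
∣fromList∣≤length (x ∷ xs) =
  ≤-trans (∣⁅x⁆∪p∣≤1+∣p∣ x (fromList xs)) (s≤s (∣fromList∣≤length xs))

record Finite (A : Set) : Set where
  field
    size  : ℕ
    index : A ↔ Fin size

  encode : A → Fin size
  encode = Inverse.to index

  decode : Fin size → A
  decode = Inverse.from index

  encode-decode : ∀ i → encode (decode i) ≡ i
  encode-decode = Inverse.strictlyInverseˡ index

  decode-encode : ∀ x → decode (encode x) ≡ x
  decode-encode = Inverse.strictlyInverseʳ index

  encode-injective : ∀ {x y} → encode x ≡ encode y → x ≡ y
  encode-injective {x} {y} eq = trans (sym (decode-encode x)) (trans (cong decode eq) (decode-encode y))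

  decode-injective : ∀ {i j} → decode i ≡ decode j → i ≡ j
  decode-injective {i} {j} eq = trans (sym (encode-decode i)) (trans (cong encode eq) (encode-decode j))

finite-Fin : ∀ n → Finite (Fin n)
finite-Fin n = record { index = ↔-refl }

finite-⊎ : ∀ {A B} → Finite A → Finite B → Finite (A ⊎ B)
finite-⊎ FA FB = record { index = ↔-trans (Finite.index FA ⊎-↔ Finite.index FB) (↔-sym +↔⊎) }

finite-× : ∀ {A B} → Finite A → Finite B → Finite (A × B)
finite-× FA FB = record { index = ↔-trans (Finite.index FA ×-↔ Finite.index FB) (↔-sym *↔×) }

-- Tree decompositions presented by parent pointers, with depth decreasing towards the root; the
-- nodes whose bag contains v are closed under taking parents, up to the node top v.
record RootedDecomposition {V : Set} (E : V → V → Set) (t : ℕ) : Set₁ where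
  field
    Node      : Set
    nodes     : Finite Node
    parent    : Node → Node
    depth     : Node → ℕ
    root      : Node
    descends  : ∀ x → x ≡ root ⊎ depth (parent x) < depth x
    bag       : Node → List V
    width     : ∀ x → length (bag x) ≤ suc t
    covers    : ∀ {u v} → E u v → Σ Node λ x → u ∈ bag x × v ∈ bag x
    top       : V → Node
    ∈-top     : ∀ v → v ∈ bag (top v)
    ∈-parent  : ∀ {v x} → v ∈ bag x → x ≡ top v ⊎ (x ≢ root × v ∈ bag (parent x))

module Realisation {V : Set} (vertices : Finite V) (E : V → V → Set)
                   (E-sym : Symmetric E) (E-irrefl : ∀ {u} → ¬ E u u) where
  open Finite vertices

  graph : Graph size
  graph = record { Adj = λ i j → E (decode i) (decode j) ; sym = E-sym ; irrefl = E-irrefl }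

  walk⁺ : ∀ {u v k} → RWalk E u v k → Walk graph (encode u) (encode v) k
  walk⁺ nil = nil
  walk⁺ (cons e p) = cons (subst₂ E (sym (decode-encode _)) (sym (decode-encode _)) e) (walk⁺ p)

  walk⁻ : ∀ {u v k} → Walk graph (encode u) (encode v) k → RWalk E u v k
  walk⁻ {u} {v} {k} p = subst₂ (λ x y → RWalk E x y k) (decode-encode u) (decode-encode v) (decoded p)
    where
    decoded : ∀ {i j k} → Walk graph i j k → RWalk E (decode i) (decode j) k
    decoded nil = nil
    decoded (cons e p) = cons e (decoded p)

  module _ {t : ℕ} (D : RootedDecomposition E t) where
    open RootedDecomposition D
    module N = Finite nodes

    ParentEdge : Node → Node → Set
    ParentEdge x y = (y ≡ parent x × depth y < depth x) ⊎ (x ≡ parent y × depth x < depth y)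

    tree : Graph N.size
    tree = record
      { Adj    = λ i j → ParentEdge (N.decode i) (N.decode j)
      ; sym    = λ { (inj₁ e) → inj₂ e ; (inj₂ e) → inj₁ e }
      ; irrefl = λ { (inj₁ (_ , lt)) → <-irrefl refl lt ; (inj₂ (_ , lt)) → <-irrefl refl lt }
      }

    depthᶠ : Fin N.size → ℕ
    depthᶠ i = depth (N.decode i)

    up-edge : ∀ i → depth (parent (N.decode i)) < depth (N.decode i) →
              Adj tree i (N.encode (parent (N.decode i))) × depthᶠ (N.encode (parent (N.decode i))) < depthᶠ i
    up-edge i lt rewrite N.decode-encode (parent (N.decode i)) = inj₁ (refl , lt) , lt

    at-node : ∀ {i x} → N.decode i ≡ x → i ≡ N.encode x
    at-node {i} refl = sym (N.encode-decode i)

    tree-connected : Connected tree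
    tree-connected i j = walkIn⇒walk (connected-towards step i j tt tt)
      where
      step : StepsTowards tree (λ _ → ⊤) depthᶠ (N.encode root)
      step {i} _ with descends (N.decode i)
      ... | inj₁ i≡root = inj₁ (at-node i≡root)
      ... | inj₂ lt with e , lt′ ← up-edge i lt = inj₂ (_ , e , tt , lt′)

    tree-acyclic : ¬ HasCycle tree
    tree-acyclic = acyclic-by-depth tree depthᶠ unique-shallower
      where
      to-parent : ∀ {x y} → ParentEdge x y → depth y ≤ depth x → y ≡ parent x
      to-parent (inj₁ (y≡px , _)) _ = y≡px
      to-parent (inj₂ (_ , x<y)) y≤x = ⊥-elim (<⇒≱ x<y y≤x)
      unique-shallower : ∀ {i j k} → Adj tree i j → Adj tree i k →
                         depthᶠ j ≤ depthᶠ i → depthᶠ k ≤ depthᶠ i → j ≡ k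
      unique-shallower e e′ j≤i k≤i = N.decode-injective (trans (to-parent e j≤i) (sym (to-parent e′ k≤i)))

    bagᶠ : Fin N.size → Subset size
    bagᶠ i = fromList (map encode (bag (N.decode i)))

    ∈-bagᶠ⁺ : ∀ {v x} → decode v ∈ bag x → v ∈ₛ bagᶠ (N.encode x)
    ∈-bagᶠ⁺ {v} {x} v∈x rewrite N.decode-encode x =
      ∈-fromList⁺ (subst (_∈ map encode (bag x)) (encode-decode v) (∈-map⁺ encode v∈x))

    ∈-bagᶠ⁻ : ∀ {v i} → v ∈ₛ bagᶠ i → decode v ∈ bag (N.decode i)
    ∈-bagᶠ⁻ {v} {i} v∈i with w , w∈i , refl ← ∈-map⁻ encode (∈-fromList⁻ _ v∈i)
      = subst (_∈ bag (N.decode i)) (sym (decode-encode w)) w∈i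

    bags-connected : ∀ v → ConnectedOn tree (λ i → v ∈ₛ bagᶠ i)
    bags-connected v = connected-towards step
      where
      step : StepsTowards tree (λ i → v ∈ₛ bagᶠ i) depthᶠ (N.encode (top (decode v)))
      step {i} v∈i with ∈-parent (∈-bagᶠ⁻ v∈i)
      ... | inj₁ i≡top = inj₁ (at-node i≡top)
      ... | inj₂ (i≢root , v∈parent) with descends (N.decode i)
      ...   | inj₁ i≡root = ⊥-elim (i≢root i≡root)
      ...   | inj₂ lt with e , lt′ ← up-edge i lt = inj₂ (_ , e , ∈-bagᶠ⁺ v∈parent , lt′)

    treeDecomposition : TreeDecomposition graph t
    treeDecomposition = record
      { m         = N.size
      ; T         = tree
      ; tree      = ≤-trans (s≤s z≤n) (toℕ<n (N.encode root)) , tree-connected , tree-acyclic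
      ; bag       = bagᶠ
      ; covVertex = λ v → _ , ∈-bagᶠ⁺ (∈-top (decode v))
      ; covEdge   = λ u v e → let x , u∈x , v∈x = covers e in _ , ∈-bagᶠ⁺ u∈x , ∈-bagᶠ⁺ v∈x
      ; connected = bags-connected
      ; width     = λ i → let xs = bag (N.decode i) in
                      ≤-trans (∣fromList∣≤length (map encode xs))
                              (≤-trans (≤-reflexive (length-map encode xs)) (width (N.decode i)))
      }

record Gadget (d t ℓ : ℕ) : Set₁ where
  field
    V             : Set
    vertices      : Finite V
    E             : V → V → Set
    E-sym         : Symmetric E
    E-irrefl      : ∀ {u} → ¬ E u u
    a b           : Fin ℓ → V
    a-injective   : Injective _≡_ _≡_ a
    b-injective   : Injective _≡_ _≡_ b
    a≢b           : ∀ i j → a i ≢ b j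
    long          : ∀ {i j k} → RWalk E (b i) (a j) k → d ≤ k
    short⇒<       : ∀ {i j k} → RWalk E (b i) (a j) k → k ≤ d → i <ᶠ j
    <⇒short       : ∀ {i j} → i <ᶠ j → Σ ℕ λ k → k ≤ d × RWalk E (b i) (a j) k
    decomposition : RootedDecomposition E t
  open RootedDecomposition decomposition public
  field
    pair-node     : Fin ℓ → Node
    a∈pair-node   : ∀ i → a i ∈ bag (pair-node i)
    b∈pair-node   : ∀ i → b i ∈ bag (pair-node i)

realise : ∀ {d t ℓ} → Gadget d t ℓ → Σ ℕ λ n → Σ (Graph n) λ G → TreewidthAtMost G t × HalfGraph G d ℓ
realise {d} {t} {ℓ} G = _ , graph , treeDecomposition decomposition , halfGraph
  where
  open Gadget G
  open Realisation vertices E E-sym E-irrefl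
  open Finite vertices

  halfGraph : HalfGraph graph d ℓ
  halfGraph = record
    { a     = encode ∘′ a
    ; b     = encode ∘′ b
    ; a-inj = a-injective ∘′ encode-injective
    ; b-inj = b-injective ∘′ encode-injective
    ; a≢b   = λ i j → a≢b i j ∘′ encode-injective
    ; half⇒ = λ { i j (k , k≤d , p) → short⇒< (walk⁻ p) k≤d }
    ; half⇐ = λ i j i<j → let k , k≤d , p = <⇒short i<j in k , k≤d , walk⁺ p
    }

single-pair-gadget : ∀ {d s} → Gadget d (suc s) 1
single-pair-gadget = record
  { V             = Bool
  ; vertices      = record { index = ↔-sym 2↔Bool }
  ; E             = λ _ _ → ⊥
  ; E-sym         = λ ()
  ; E-irrefl      = λ ()
  ; a             = λ _ → false
  ; b             = λ _ → true
  ; a-injective   = λ { {zero} {zero} _ → refl }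
  ; b-injective   = λ { {zero} {zero} _ → refl }
  ; a≢b           = λ _ _ ()
  ; long          = λ { (cons () _) }
  ; short⇒<       = λ { (cons () _) }
  ; <⇒short       = λ { {zero} {zero} () }
  ; decomposition = record
    { Node     = ⊤
    ; nodes    = record { index = ↔-sym 1↔⊤ }
    ; parent   = λ _ → tt
    ; depth    = λ _ → 0
    ; root     = tt
    ; descends = λ _ → inj₁ refl
    ; bag      = λ _ → false ∷ true ∷ []
    ; width    = λ _ → s≤s (s≤s z≤n)
    ; covers   = λ ()
    ; top      = λ _ → tt
    ; ∈-top    = λ { false → here refl ; true → there (here refl) }
    ; ∈-parent = λ _ → inj₁ refl
    }
  ; pair-node     = λ _ → tt
  ; a∈pair-node   = λ _ → here refl
  ; b∈pair-node   = λ _ → there (here refl)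
  }

data PathVertex : Set where
  b₀ mid a₁ a₀ b₁ : PathVertex

data PathEdge : PathVertex → PathVertex → Set where
  b₀-mid : PathEdge b₀ mid
  mid-b₀ : PathEdge mid b₀
  mid-a₁ : PathEdge mid a₁
  a₁-mid : PathEdge a₁ mid

onPath : PathVertex → Bool
onPath a₀ = false
onPath b₁ = false
onPath _  = true

onPath-walk : ∀ {u v k} → RWalk PathEdge u v k → onPath u ≡ onPath v
onPath-walk nil = refl
onPath-walk (cons b₀-mid p) = onPath-walk p
onPath-walk (cons mid-b₀ p) = onPath-walk p
onPath-walk (cons mid-a₁ p) = onPath-walk p
onPath-walk (cons a₁-mid p) = onPath-walk p

path-gadget : ∀ {t} → 3 ≤ t → Gadget 2 t 2
path-gadget 3≤t = record
  { V             = PathVertex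
  ; vertices      = record { index = mk↔ₛ′ encode decode encode-decode decode-encode }
  ; E             = PathEdge
  ; E-sym         = λ { b₀-mid → mid-b₀ ; mid-b₀ → b₀-mid ; mid-a₁ → a₁-mid ; a₁-mid → mid-a₁ }
  ; E-irrefl      = λ ()
  ; a             = a
  ; b             = b
  ; a-injective   = λ { {zero} {zero} _ → refl ; {suc zero} {suc zero} _ → refl
                      ; {zero} {suc zero} () ; {suc zero} {zero} () }
  ; b-injective   = λ { {zero} {zero} _ → refl ; {suc zero} {suc zero} _ → refl
                      ; {zero} {suc zero} () ; {suc zero} {zero} () }
  ; a≢b           = λ { zero zero () ; zero (suc zero) () ; (suc zero) zero () ; (suc zero) (suc zero) () }
  ; long          = long
  ; short⇒<       = short⇒<
  ; <⇒short       = λ { {zero} {suc zero} _ → 2 , ≤-refl , cons b₀-mid (cons mid-a₁ nil)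
                      ; {suc zero} {suc zero} (s≤s ()) }
  ; decomposition = record
    { Node     = Bool
    ; nodes    = record { index = ↔-sym 2↔Bool }
    ; parent   = λ _ → true
    ; depth    = λ { true → 0 ; false → 1 }
    ; root     = true
    ; descends = λ { true → inj₁ refl ; false → inj₂ (s≤s z≤n) }
    ; bag      = bag
    ; width    = λ { true → s≤s 3≤t ; false → s≤s (≤-trans (s≤s z≤n) 3≤t) }
    ; covers   = λ { b₀-mid → true , here refl , there (here refl)
                   ; mid-b₀ → true , there (here refl) , here refl
                   ; mid-a₁ → true , there (here refl) , there (there (here refl))
                   ; a₁-mid → true , there (there (here refl)) , there (here refl) }
    ; top      = top
    ; ∈-top    = λ { b₀ → here refl ; mid → there (here refl) ; a₁ → there (there (here refl))
                   ; a₀ → there (there (there (here refl))) ; b₁ → there (here refl) }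
    ; ∈-parent = λ { {x = true} v∈root → inj₁ (top-of-root v∈root)
                   ; {x = false} (here refl) → inj₂ ((λ ()) , there (there (here refl)))
                   ; {x = false} (there (here refl)) → inj₁ refl }
    }
  ; pair-node     = λ { zero → true ; (suc zero) → false }
  ; a∈pair-node   = λ { zero → there (there (there (here refl))) ; (suc zero) → here refl }
  ; b∈pair-node   = λ { zero → here refl ; (suc zero) → there (here refl) }
  }
  where
  a b : Fin 2 → PathVertex
  a zero = a₀
  a (suc zero) = a₁
  b zero = b₀
  b (suc zero) = b₁

  encode : PathVertex → Fin 5
  encode b₀ = zero
  encode mid = suc zero
  encode a₁ = suc (suc zero)
  encode a₀ = suc (suc (suc zero))
  encode b₁ = suc (suc (suc (suc zero)))

  decode : Fin 5 → PathVertex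
  decode zero = b₀
  decode (suc zero) = mid
  decode (suc (suc zero)) = a₁
  decode (suc (suc (suc zero))) = a₀
  decode (suc (suc (suc (suc zero)))) = b₁

  encode-decode : ∀ i → encode (decode i) ≡ i
  encode-decode zero = refl
  encode-decode (suc zero) = refl
  encode-decode (suc (suc zero)) = refl
  encode-decode (suc (suc (suc zero))) = refl
  encode-decode (suc (suc (suc (suc zero)))) = refl

  decode-encode : ∀ v → decode (encode v) ≡ v
  decode-encode b₀ = refl
  decode-encode mid = refl
  decode-encode a₁ = refl
  decode-encode a₀ = refl
  decode-encode b₁ = refl

  long : ∀ {i j k} → RWalk PathEdge (b i) (a j) k → 2 ≤ k
  long {zero} {zero} p with () ← onPath-walk p
  long {zero} {suc zero} (cons b₀-mid (cons _ _)) = s≤s (s≤s z≤n)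
  long {suc zero} {zero} (cons () _)
  long {suc zero} {suc zero} (cons () _)

  short⇒< : ∀ {i j k} → RWalk PathEdge (b i) (a j) k → k ≤ 2 → i <ᶠ j
  short⇒< {zero} {zero} p with () ← onPath-walk p
  short⇒< {zero} {suc zero} _ _ = s≤s z≤n
  short⇒< {suc zero} {zero} (cons () _)
  short⇒< {suc zero} {suc zero} (cons () _)

  bag : Bool → List PathVertex
  bag true  = b₀ ∷ mid ∷ a₁ ∷ a₀ ∷ []
  bag false = a₁ ∷ b₁ ∷ []

  top : PathVertex → Bool
  top b₁ = false
  top _  = true

  top-of-root : ∀ {v} → v ∈ bag true → true ≡ top v
  top-of-root (here refl) = refl
  top-of-root (there (here refl)) = refl
  top-of-root (there (there (here refl))) = refl
  top-of-root (there (there (there (here refl)))) = refl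

_≺_ : ∀ {p q} → Fin p × Fin q → Fin p × Fin q → Set
_≺_ = ×-Lex _≡_ _<ᶠ_ _<ᶠ_

lex⇒combine-< : ∀ {p q} {i₁ j₁ : Fin p} {i₂ j₂ : Fin q} →
                (i₁ , i₂) ≺ (j₁ , j₂) → combine i₁ i₂ <ᶠ combine j₁ j₂
lex⇒combine-< {i₂ = i₂} {j₂} (inj₁ i₁<j₁) = combine-monoˡ-< i₂ j₂ i₁<j₁
lex⇒combine-< {q = q} {i₁} {i₂ = i₂} {j₂} (inj₂ (refl , i₂<j₂))
  rewrite toℕ-combine i₁ i₂ | toℕ-combine i₁ j₂ = +-monoʳ-< (q * toℕ i₁) i₂<j₂

combine-<⇒lex : ∀ {p q} {i₁ j₁ : Fin p} {i₂ j₂ : Fin q} →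
                combine i₁ i₂ <ᶠ combine j₁ j₂ → (i₁ , i₂) ≺ (j₁ , j₂)
combine-<⇒lex {q = q} {i₁} {j₁} {i₂} {j₂} lt with <ᶠ-cmp i₁ j₁
... | tri< i₁<j₁ _ _ = inj₁ i₁<j₁
... | tri> _ _ j₁<i₁ = ⊥-elim (<-asym lt (combine-monoˡ-< j₂ i₂ j₁<i₁))
... | tri≈ _ refl _ rewrite toℕ-combine i₁ i₂ | toℕ-combine i₁ j₂ =
  inj₂ (refl , +-cancelˡ-< (q * toℕ i₁) (toℕ i₂) (toℕ j₂) lt)

module Product {d t s p q : ℕ} (G₁ : Gadget d t p) (G₂ : Gadget (2 + d) s q) (s+2≤t : 2 + s ≤ t) where
  private
    module G₁ = Gadget G₁
    module G₂ = Gadget G₂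

  V : Set
  V = G₁.V ⊎ (Fin p × G₂.V)

  copy : Fin p → G₂.V → V
  copy i v = inj₂ (i , v)

  data Attached (i : Fin p) : G₁.V → G₂.V → Set where
    b-b : ∀ m → Attached i (G₁.b i) (G₂.b m)
    a-a : ∀ m → Attached i (G₁.a i) (G₂.a m)

  E : V → V → Set
  E (inj₁ u) (inj₁ v) = G₁.E u v
  E (inj₁ u) (inj₂ (i , v)) = Attached i u v
  E (inj₂ (i , v)) (inj₁ u) = Attached i u v
  E (inj₂ (i , u)) (inj₂ (j , v)) = i ≡ j × G₂.E u v

  E-sym : Symmetric E
  E-sym {inj₁ _} {inj₁ _} e = G₁.E-sym e
  E-sym {inj₁ _} {inj₂ _} e = e
  E-sym {inj₂ _} {inj₁ _} e = e
  E-sym {inj₂ _} {inj₂ _} (refl , e) = refl , G₂.E-sym e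

  E-irrefl : ∀ {u} → ¬ E u u
  E-irrefl {inj₁ _} e = G₁.E-irrefl e
  E-irrefl {inj₂ _} (_ , e) = G₂.E-irrefl e

  module Towards (j₁ : Fin p) (j₂ : Fin q) where
    target : V
    target = copy j₁ (G₂.a j₂)

    -- What a walk of length n from u to the target yields: it is long, or a shorter G₁-walk exists.
    Shortcut : G₁.V → ℕ → Set
    Shortcut u n = 2 + d ≤ n ⊎ Σ ℕ λ k → k < n × RWalk G₁.E u (G₁.a j₁) k

    shortcut-mono : ∀ {u m n} → m ≤ n → Shortcut u m → Shortcut u n
    shortcut-mono m≤n (inj₁ long) = inj₁ (≤-trans long m≤n)
    shortcut-mono m≤n (inj₂ (k , k<m , p)) = inj₂ (k , <-≤-trans k<m m≤n , p)

    shortcut-cons : ∀ {u v n} → G₁.E u v → Shortcut v n → Shortcut u (suc n)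
    shortcut-cons e (inj₁ long) = inj₁ (m≤n⇒m≤1+n long)
    shortcut-cons e (inj₂ (k , k<n , p)) = inj₂ (suc k , s≤s k<n , cons e p)

    long-prefix : ∀ {u k n} → 2 + d ≤ k → Shortcut u (suc (k + n))
    long-prefix {k = k} {n} long = inj₁ (≤-trans long (m≤n⇒m≤1+n (m≤m+n k n)))

    resume : ∀ {u k n} → Shortcut u n → Shortcut u (suc (k + suc n))
    resume {k = k} {n} = shortcut-mono (m≤n⇒m≤1+n (≤-trans (n≤1+n n) (m≤n+m (suc n) k)))

    extend : ∀ {u k n} → Shortcut u (suc (suc k + n)) → Shortcut u (suc (k + suc n))
    extend {k = k} {n} = subst (Shortcut _) (cong suc (sym (+-suc k n)))

    -- Inside a copy every b–a stretch has length at least d + 2, so a walk that enters a copy at a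
    -- b-vertex (resp. an a-vertex) gains nothing unless it comes back out to b₁ c (resp. a₁ c).
    mutual
      shortcut : ∀ {u n} → RWalk E (inj₁ u) target n → Shortcut u n
      shortcut (cons {v = inj₁ _} e w) = shortcut-cons e (shortcut w)
      shortcut (cons {v = inj₂ _} (b-b _) w) = shortcut-via-b nil w
      shortcut (cons {v = inj₂ _} (a-a _) w) = shortcut-via-a nil w

      shortcut-via-b : ∀ {c m x k n} → RWalk G₂.E (G₂.b m) x k → RWalk E (copy c x) target n →
                       Shortcut (G₁.b c) (suc (k + n))
      shortcut-via-b p nil = long-prefix (G₂.long p)
      shortcut-via-b p (cons {v = inj₂ _} (refl , e) w) = extend (shortcut-via-b (walk-snoc p e) w)
      shortcut-via-b p (cons {v = inj₁ _} (b-b _) w) = resume (shortcut w)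
      shortcut-via-b p (cons {v = inj₁ _} (a-a _) w) = long-prefix (G₂.long p)

      shortcut-via-a : ∀ {c m x k n} → RWalk G₂.E (G₂.a m) x k → RWalk E (copy c x) target n →
                       Shortcut (G₁.a c) (suc (k + n))
      shortcut-via-a p nil = inj₂ (0 , s≤s z≤n , nil)
      shortcut-via-a p (cons {v = inj₂ _} (refl , e) w) = extend (shortcut-via-a (walk-snoc p e) w)
      shortcut-via-a p (cons {v = inj₁ _} (b-b _) w) = long-prefix (G₂.long (walk-reverse G₂.E-sym p))
      shortcut-via-a p (cons {v = inj₁ _} (a-a _) w) = resume (shortcut w)

    Outcome : Fin p → Fin q → ℕ → Set
    Outcome i₁ i₂ n = 2 + d ≤ n × (n ≤ 2 + d → (i₁ , i₂) ≺ (j₁ , j₂))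

    overshoot : ∀ {i₁ i₂ m n} → 2 + d ≤ m → m < n → Outcome i₁ i₂ n
    overshoot long m<n = ≤-trans long (<⇒≤ m<n) , λ n≤ → ⊥-elim (<⇒≱ m<n (≤-trans n≤ long))

    from-pair : ∀ {i₁ i₂ x k n} → RWalk G₂.E (G₂.b i₂) x k → RWalk E (copy i₁ x) target n →
                Outcome i₁ i₂ (k + n)
    from-pair {k = k} p nil rewrite +-identityʳ k = G₂.long p , λ k≤ → inj₂ (refl , G₂.short⇒< p k≤)
    from-pair {k = k} p (cons {v = inj₂ _} {k = n} (refl , e) w) =
      subst (Outcome _ _) (sym (+-suc k n)) (from-pair (walk-snoc p e) w)
    from-pair {k = k} p (cons {v = inj₁ _} (a-a _) w) = overshoot (G₂.long p) (m<m+n k (s≤s z≤n))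
    from-pair {k = k} p (cons {v = inj₁ _} {k = n} (b-b _) w) with shortcut w
    ... | inj₁ long = overshoot long (m≤n+m (suc n) k)
    ... | inj₂ (k₁ , k₁<n , p₁) =
      ≤-trans (s≤s (s≤s (G₁.long p₁))) 2+k₁≤ ,
      λ ≤2+d → inj₁ (G₁.short⇒< p₁ (≤-pred (≤-pred (≤-trans 2+k₁≤ ≤2+d))))
      where
      2+k₁≤ : 2 + k₁ ≤ k + suc n
      2+k₁≤ = ≤-trans (s≤s k₁<n) (m≤n+m (suc n) k)

  a′ b′ : Fin p × Fin q → V
  a′ (i₁ , i₂) = copy i₁ (G₂.a i₂)
  b′ (i₁ , i₂) = copy i₁ (G₂.b i₂)

  outcome : ∀ {i j n} → RWalk E (b′ i) (a′ j) n → Towards.Outcome (proj₁ j) (proj₂ j) (proj₁ i) (proj₂ i) n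
  outcome {j = j₁ , j₂} = Towards.from-pair j₁ j₂ nil

  ≺⇒short : ∀ {i j} → i ≺ j → Σ ℕ λ n → n ≤ 2 + d × RWalk E (b′ i) (a′ j) n
  ≺⇒short {i₁ , i₂} {j₁ , j₂} (inj₁ i₁<j₁) with k , k≤d , p ← G₁.<⇒short i₁<j₁ =
    2 + k , s≤s (s≤s k≤d) , cons (b-b i₂) (walk-snoc (walk-map inj₁ (λ e → e) p) (a-a j₂))
  ≺⇒short {i₁ , i₂} {.i₁ , j₂} (inj₂ (refl , i₂<j₂)) with k , k≤ , p ← G₂.<⇒short i₂<j₂ =
    k , k≤ , walk-map (copy i₁) (refl ,_) p

  Node : Set
  Node = G₁.Node ⊎ (Fin p × G₂.Node)

  parent-in-copy : Fin p → (x : G₂.Node) → x ≡ G₂.root ⊎ G₂.depth (G₂.parent x) < G₂.depth x → Node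
  parent-in-copy i x (inj₁ _) = inj₁ (G₁.pair-node i)
  parent-in-copy i x (inj₂ _) = inj₂ (i , G₂.parent x)

  parent : Node → Node
  parent (inj₁ x) = inj₁ (G₁.parent x)
  parent (inj₂ (i , x)) = parent-in-copy i x (G₂.descends x)

  depth : Node → ℕ
  depth (inj₁ x) = G₁.depth x
  depth (inj₂ (i , x)) = suc (G₁.depth (G₁.pair-node i) + G₂.depth x)

  descends : ∀ x → x ≡ inj₁ G₁.root ⊎ depth (parent x) < depth x
  descends (inj₁ x) = Sum.map₁ (cong inj₁) (G₁.descends x)
  descends (inj₂ (i , x)) with G₂.descends x
  ... | inj₁ _ = inj₂ (s≤s (m≤m+n _ _))
  ... | inj₂ lt = inj₂ (s≤s (+-monoʳ-< _ lt))

  bag : Node → List V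
  bag (inj₁ x) = map inj₁ (G₁.bag x)
  bag (inj₂ (i , x)) = inj₁ (G₁.b i) ∷ inj₁ (G₁.a i) ∷ map (copy i) (G₂.bag x)

  width : ∀ x → length (bag x) ≤ suc t
  width (inj₁ x) = ≤-trans (≤-reflexive (length-map inj₁ (G₁.bag x))) (G₁.width x)
  width (inj₂ (i , x)) =
    ≤-trans (s≤s (s≤s (≤-trans (≤-reflexive (length-map (copy i) (G₂.bag x))) (G₂.width x)))) (s≤s s+2≤t)

  ∈-copy : ∀ {i v x} → v ∈ G₂.bag x → copy i v ∈ bag (inj₂ (i , x))
  ∈-copy {i} v∈x = there (there (∈-map⁺ (copy i) v∈x))

  covers-attached : ∀ {i u v} → Attached i u v → Σ Node λ x → inj₁ u ∈ bag x × copy i v ∈ bag x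
  covers-attached {i} (b-b m) = inj₂ (i , G₂.top (G₂.b m)) , here refl , ∈-copy (G₂.∈-top _)
  covers-attached {i} (a-a m) = inj₂ (i , G₂.top (G₂.a m)) , there (here refl) , ∈-copy (G₂.∈-top _)

  covers : ∀ {u v} → E u v → Σ Node λ x → u ∈ bag x × v ∈ bag x
  covers {inj₁ _} {inj₁ _} e with x , u∈x , v∈x ← G₁.covers e =
    inj₁ x , ∈-map⁺ inj₁ u∈x , ∈-map⁺ inj₁ v∈x
  covers {inj₁ _} {inj₂ _} e = covers-attached e
  covers {inj₂ _} {inj₁ _} e with x , u∈x , v∈x ← covers-attached e = x , v∈x , u∈x
  covers {inj₂ (i , _)} {inj₂ _} (refl , e) with x , u∈x , v∈x ← G₂.covers e =
    inj₂ (i , x) , ∈-copy u∈x , ∈-copy v∈x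

  top : V → Node
  top (inj₁ v) = inj₁ (G₁.top v)
  top (inj₂ (i , v)) = inj₂ (i , G₂.top v)

  ∈-top : ∀ v → v ∈ bag (top v)
  ∈-top (inj₁ v) = ∈-map⁺ inj₁ (G₁.∈-top v)
  ∈-top (inj₂ (i , v)) = ∈-copy (G₂.∈-top v)

  attachments-in-parent : ∀ i y → let x = parent (inj₂ (i , y)) in
                          inj₁ (G₁.b i) ∈ bag x × inj₁ (G₁.a i) ∈ bag x
  attachments-in-parent i y with G₂.descends y
  ... | inj₁ _ = ∈-map⁺ inj₁ (G₁.b∈pair-node i) , ∈-map⁺ inj₁ (G₁.a∈pair-node i)
  ... | inj₂ _ = here refl , there (here refl)

  ∈-parent-copy : ∀ {i w y} → w ∈ G₂.bag y →
    inj₂ (i , y) ≡ top (copy i w) ⊎ (inj₂ (i , y) ≢ inj₁ G₁.root × copy i w ∈ bag (parent (inj₂ (i , y))))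
  ∈-parent-copy {i} {w} {y} w∈y with G₂.∈-parent w∈y
  ... | inj₁ y≡top = inj₁ (cong (λ z → inj₂ (i , z)) y≡top)
  ... | inj₂ (y≢root , w∈py) with G₂.descends y
  ...   | inj₁ y≡root = ⊥-elim (y≢root y≡root)
  ...   | inj₂ _ = inj₂ ((λ ()) , ∈-copy w∈py)

  ∈-parent : ∀ {v x} → v ∈ bag x → x ≡ top v ⊎ (x ≢ inj₁ G₁.root × v ∈ bag (parent x))
  ∈-parent {inj₁ _} {inj₁ y} v∈y with _ , w∈y , refl ← ∈-map⁻ inj₁ v∈y =
    Sum.map (cong inj₁) (Prod.map (_∘ inj₁-injective) (∈-map⁺ inj₁)) (G₁.∈-parent w∈y)
  ∈-parent {inj₁ _} {inj₂ (i , y)} (here refl) = inj₂ ((λ ()) , proj₁ (attachments-in-parent i y))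
  ∈-parent {inj₁ _} {inj₂ (i , y)} (there (here refl)) = inj₂ ((λ ()) , proj₂ (attachments-in-parent i y))
  ∈-parent {inj₁ _} {inj₂ (i , y)} (there (there v∈y)) with _ , _ , () ← ∈-map⁻ (copy i) v∈y
  ∈-parent {inj₂ _} {inj₁ y} v∈y with _ , _ , () ← ∈-map⁻ inj₁ v∈y
  ∈-parent {inj₂ _} {inj₂ (i , y)} (there (there v∈y)) with _ , w∈y , refl ← ∈-map⁻ (copy i) v∈y =
    ∈-parent-copy w∈y

  decomposition : RootedDecomposition E t
  decomposition = record
    { Node     = Node
    ; nodes    = finite-⊎ G₁.nodes (finite-× (finite-Fin p) G₂.nodes)
    ; parent   = parent
    ; depth    = depth
    ; root     = inj₁ G₁.root
    ; descends = descends
    ; bag      = bag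
    ; width    = width
    ; covers   = covers
    ; top      = top
    ; ∈-top    = ∈-top
    ; ∈-parent = ∈-parent
    }

  split : Fin (p * q) → Fin p × Fin q
  split = remQuot {p} q

  combine-split : ∀ I → uncurry combine (split I) ≡ I
  combine-split = combine-remQuot {p} q

  split-injective : ∀ {I J} → split I ≡ split J → I ≡ J
  split-injective {I} {J} eq = trans (sym (combine-split I)) (trans (cong (uncurry combine) eq) (combine-split J))

  split-<⇒≺ : ∀ {I J} → I <ᶠ J → split I ≺ split J
  split-<⇒≺ {I} {J} I<J = combine-<⇒lex (subst₂ _<ᶠ_ (sym (combine-split I)) (sym (combine-split J)) I<J)

  split-≺⇒< : ∀ {I J} → split I ≺ split J → I <ᶠ J
  split-≺⇒< {I} {J} lex = subst₂ _<ᶠ_ (combine-split I) (combine-split J) (lex⇒combine-< lex)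

  copy-injective : ∀ {f : Fin q → G₂.V} → (∀ {m n} → f m ≡ f n → m ≡ n) →
                   ∀ {i j} → copy (proj₁ i) (f (proj₂ i)) ≡ copy (proj₁ j) (f (proj₂ j)) → i ≡ j
  copy-injective f-inj eq with refl , eq₂ ← ,-injective (inj₂-injective eq) = cong (_ ,_) (f-inj eq₂)

  gadget : Gadget (2 + d) t (p * q)
  gadget = record
    { V             = V
    ; vertices      = finite-⊎ G₁.vertices (finite-× (finite-Fin p) G₂.vertices)
    ; E             = E
    ; E-sym         = λ {u} {v} → E-sym {u} {v}
    ; E-irrefl      = λ {u} → E-irrefl {u}
    ; a             = a′ ∘ split
    ; b             = b′ ∘ split
    ; a-injective   = split-injective ∘′ copy-injective G₂.a-injective
    ; b-injective   = split-injective ∘′ copy-injective G₂.b-injective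
    ; a≢b           = λ I J → G₂.a≢b _ _ ∘′ proj₂ ∘′ ,-injective ∘′ inj₂-injective
    ; long          = proj₁ ∘′ outcome
    ; short⇒<       = λ w n≤ → split-≺⇒< (proj₂ (outcome w) n≤)
    ; <⇒short       = ≺⇒short ∘′ split-<⇒≺
    ; decomposition = decomposition
    ; pair-node     = λ I → inj₂ (proj₁ (split I) , G₂.pair-node (proj₂ (split I)))
    ; a∈pair-node   = λ I → ∈-copy (G₂.a∈pair-node (proj₂ (split I)))
    ; b∈pair-node   = λ I → ∈-copy (G₂.b∈pair-node (proj₂ (split I)))
    }

pascal-exponent : ∀ D K → 2 ^ ((D + suc K) C suc K) * 2 ^ ((suc D + K) C K) ≡ 2 ^ ((suc D + suc K) C suc K)
pascal-exponent D K = begin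
  2 ^ (n C suc K) * 2 ^ (suc (D + K) C K)  ≡⟨ ^-distribˡ-+-* 2 (n C suc K) (suc (D + K) C K) ⟨
  2 ^ (n C suc K + suc (D + K) C K)        ≡⟨ cong (λ m → 2 ^ (n C suc K + m C K)) (sym (+-suc D K)) ⟩
  2 ^ (n C suc K + n C K)                  ≡⟨ cong (2 ^_) (+-comm (n C suc K) (n C K)) ⟩
  2 ^ (n C K + n C suc K)                  ≡⟨ cong (2 ^_) (nCk+nC[k+1]≡[n+1]C[k+1] n K) ⟩
  2 ^ (suc n C suc K)                      ∎
  where
  open ≡-Reasoning
  n = D + suc K

gadget : ∀ D K → Gadget (suc D * 2) (3 + K * 2) (2 ^ ((D + K) C K))
gadget zero K = subst (Gadget 2 (3 + K * 2)) (cong (2 ^_) (sym (nCn≡1 K))) (path-gadget (m≤m+n 3 (K * 2)))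
gadget (suc D) zero = Product.gadget (gadget D zero) single-pair-gadget ≤-refl
gadget (suc D) (suc K) =
  subst (Gadget _ _) (pascal-exponent D K) (Product.gadget (gadget D (suc K)) (gadget (suc D) K) ≤-refl)

even≥2-form : ∀ {d} → 2 ≤ d → 2 ∣ d → Σ ℕ λ D → d ≡ suc D * 2
even≥2-form () (divides zero refl)
even≥2-form _ (divides (suc D) refl) = D , refl

odd-form : ∀ t → ¬ 2 ∣ t → Σ ℕ λ q → t ≡ suc (q * 2)
odd-form zero 2∤0 = ⊥-elim (2∤0 (divides 0 refl))
odd-form (suc zero) _ = 0 , refl
odd-form (suc (suc t)) 2∤2+t with q , refl ← odd-form t (2∤2+t ∘ ∣m∣n⇒∣m+n ∣-refl) = suc q , refl

odd≥3-form : ∀ {t} → 3 ≤ t → ¬ 2 ∣ t → Σ ℕ λ K → t ≡ 3 + K * 2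
odd≥3-form {t} 3≤t 2∤t with odd-form t 2∤t
... | zero , refl = ⊥-elim (<⇒≱ 3≤t (s≤s z≤n))
... | suc K , refl = K , refl

⌊n*2/2⌋≡n : ∀ n → ⌊ n * 2 /2⌋ ≡ n
⌊n*2/2⌋≡n zero = refl
⌊n*2/2⌋≡n (suc n) = cong suc (⌊n*2/2⌋≡n n)

binomial-arguments : ∀ D K → (D + K) C K ≡ ⌊ suc D * 2 + (3 + K * 2) ∸ 5 /2⌋ C ⌊ 3 + K * 2 ∸ 3 /2⌋
binomial-arguments D K = cong₂ _C_ (sym first) (sym (⌊n*2/2⌋≡n K))
  where
  open ≡-Reasoning
  first : ⌊ suc D * 2 + (3 + K * 2) ∸ 5 /2⌋ ≡ D + K
  first = begin
    ⌊ D * 2 + (3 + K * 2) ∸ 3 /2⌋  ≡⟨ cong (λ m → ⌊ m ∸ 3 /2⌋) (+-comm (D * 2) (3 + K * 2)) ⟩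
    ⌊ K * 2 + D * 2 /2⌋            ≡⟨ cong ⌊_/2⌋ (*-distribʳ-+ 2 K D) ⟨
    ⌊ (K + D) * 2 /2⌋              ≡⟨ ⌊n*2/2⌋≡n (K + D) ⟩
    K + D                          ≡⟨ +-comm K D ⟩
    D + K                          ∎

theorem3p15 : (d t : ℕ) → 2 ≤ d → 2 ∣ d → 3 ≤ t → ¬ (2 ∣ t) →
    Σ ℕ λ n → Σ (Graph n) λ G →
      TreewidthAtMost G t × HalfGraph G d (2 ^ (⌊ d + t ∸ 5 /2⌋ C ⌊ t ∸ 3 /2⌋))
theorem3p15 d t 2≤d 2∣d 3≤t 2∤t with D , refl ← even≥2-form 2≤d 2∣d | K , refl ← odd≥3-form 3≤t 2∤t =
  subst (λ ℓ → Σ ℕ λ n → Σ (Graph n) λ G → TreewidthAtMost G t × HalfGraph G d (2 ^ ℓ))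
        (binomial-arguments D K) (realise (gadget D K))
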